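{- There is $n_0$ such that for all $n\ge n_0$ the following holds. Let $V=[n]$, $Z'\subseteq V$, $H'$ a graph with vertex set $Z'$, and $F'$ a bipartite graph with parts $Z'$ and $V\setminus Z'$. Let $u\in V$ and $v\in V\setminus Z'$ with $uv\notin E(F')$. Let $\mathcal{D}$ be a degree sequence on $V$ such that (E1) $d(u)\le n^{1/4}$; (E2) every $w\in V$ with $d(w)>n^{1/4}$ lies in $Z'$ and satisfies $d(w)=d_{H'}(w)$; (E3) $\sum_{w\in V\setminus Z'}(d(w)-d_{F'}(w))\ge n/20$. Then $$\mathbb{P}[uv\in E(G^{\mathcal{D}})\mid G^{\mathcal{D}}[Z']=H',\ F'\subseteq G^{\mathcal{D}}]\le 40n^{ -1/2}.$$
   Context: A degree sequence on $V=[n]$ assigns a positive integer degree $d(w)$ to each vertex and is realised by some simple graph. $G^{\mathcal{D}}$ is a uniformly random simple graph on $V$ with degree sequence $\mathcal{D}$. $G[Z']$ is the induced subgraph; $F'\subseteq G$ means $F'$ is a subgraph of $G$; $d_{H}(w)$ is the degree of $w$ in $H$ (taken as $0$ if $w\notin V(H)$). The conditioning event is assumed to have positive probability. -}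

module Defs where

open import Data.Bool using (Bool; true; false; _∧_; _∨_; not; if_then_else_)
open import Data.Nat using (ℕ; zero; suc; _≡ᵇ_)
open import Data.Fin using (Fin)
open import Data.List using (List; []; _∷_; map; concatMap; length; allFin; filterᵇ)
open import Data.Nat.ListAction using (sum)
open import Data.Bool.ListAction using (all)
open import Data.Vec.Functional using () renaming (_∷_ to _∷ᶠ_)
open import Data.Product using (Σ; _×_)
open import Relation.Binary.PropositionalEquality using (_≡_)

-- A graph with vertex set Z' ⊆ V is an adjacency relation all of whose
-- edges lie inside Z' (vertices outside Z' then have degree 0, matching the
-- convention d_H(w) = 0 for w ∉ V(H)).
Adj : ℕ → Set
Adj n = Fin n → Fin n → Bool

Subset : ℕ → Set
Subset n = Fin n → Bool

IsSimple : ∀ {n} → Adj n → Set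
IsSimple {n} G = (∀ i → G i i ≡ false) × (∀ i j → G i j ≡ G j i)

deg : ∀ {n} → Adj n → Fin n → ℕ
deg {n} G w = sum (map (λ j → if G w j then 1 else 0) (allFin n))

HasDegrees : ∀ {n} → Adj n → (Fin n → ℕ) → Set
HasDegrees {n} G d = ∀ w → deg G w ≡ d w

Realisable : ∀ {n} → (Fin n → ℕ) → Set
Realisable {n} d = Σ (Adj n) (λ G → IsSimple G × HasDegrees G d)

OnVertexSet : ∀ {n} → Adj n → Subset n → Set
OnVertexSet H Z = ∀ i j → H i j ≡ true → (Z i ≡ true × Z j ≡ true)

BipartiteAcross : ∀ {n} → Adj n → Subset n → Set
BipartiteAcross F Z = ∀ i j → F i j ≡ true → (Z i ≡ true × Z j ≡ false)
                                           ⊎' (Z i ≡ false × Z j ≡ true)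
  where
  open import Data.Sum using () renaming (_⊎_ to _⊎'_)

_⇒ᵇ_ : Bool → Bool → Bool
a ⇒ᵇ b = not a ∨ b

_==ᵇ_ : Bool → Bool → Bool
true  ==ᵇ b = b
false ==ᵇ b = not b

allPairs : ∀ {n} → (Fin n → Fin n → Bool) → Bool
allPairs {n} p = all (λ i → all (λ j → p i j) (allFin n)) (allFin n)

isSimpleᵇ : ∀ {n} → Adj n → Bool
isSimpleᵇ {n} G = all (λ i → not (G i i)) (allFin n)
                ∧ allPairs (λ i j → G i j ==ᵇ G j i)

hasDegreesᵇ : ∀ {n} → Adj n → (Fin n → ℕ) → Bool
hasDegreesᵇ {n} G d = all (λ w → deg G w ≡ᵇ d w) (allFin n)

inducedEqᵇ : ∀ {n} → Adj n → Subset n → Adj n → Bool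
inducedEqᵇ G Z H = allPairs (λ i j → (Z i ∧ Z j) ⇒ᵇ (G i j ==ᵇ H i j))

subgraphᵇ : ∀ {n} → Adj n → Adj n → Bool
subgraphᵇ F G = allPairs (λ i j → F i j ⇒ᵇ G i j)

funs : ∀ {A : Set} → List A → (n : ℕ) → List (Fin n → A)
funs xs zero    = (λ ()) ∷ []
funs xs (suc n) = concatMap (λ x → map (λ f → x ∷ᶠ f) (funs xs n)) xs

allAdj : (n : ℕ) → List (Adj n)
allAdj n = funs (funs (true ∷ false ∷ []) n) n

-- The sample space of G^D: all simple graphs on [n] with degree sequence d.
-- (G^D is uniform on this list.)
count : ∀ {n} → (Adj n → Bool) → ℕ
count {n} p = length (filterᵇ p (allAdj n))

condCount : ∀ {n} → (Fin n → ℕ) → Subset n → Adj n → Adj n → ℕ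
condCount d Z H F =
  count (λ G → isSimpleᵇ G ∧ hasDegreesᵇ G d ∧ inducedEqᵇ G Z H ∧ subgraphᵇ F G)

edgeCondCount : ∀ {n} → (Fin n → ℕ) → Subset n → Adj n → Adj n → Fin n → Fin n → ℕ
edgeCondCount d Z H F u v =
  count (λ G → isSimpleᵇ G ∧ hasDegreesᵇ G d ∧ inducedEqᵇ G Z H ∧ subgraphᵇ F G ∧ G u v)

slack : ∀ {n} → (Fin n → ℕ) → Subset n → Adj n → ℕ
slack {n} d Z F = sum (map (λ w → if Z w then 0 else (d w Data.Nat.∸ deg F w)) (allFin n))

module Submission where

-- Proof by switching.  Call G admissible if it is simple with degrees d,
-- G[Z] = H and F ⊆ G; let A count the admissible G ∋ uv and B all admissible G.
-- With K = ⌊n^(1/4)⌋, (E1) and (E2) give d(u), d(v) ≤ K and d(x) ≤ K for x ∉ Z.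
-- In G ∋ uv, a valid position is an edge xy ∈ G ∖ F with x ∉ Z, ux, vy ∉ G;
-- replacing uv, xy by ux, vy yields an admissible graph G'.  Each G ∋ uv has
-- at least slack − 4K² valid positions (slack counts the edges xy ∈ G ∖ F with
-- x ∉ Z, and each way of failing costs at most K²), while each G' arises at
-- most d(u) d(v) ≤ K² times.  Double counting gives (slack − 4K²) A ≤ K² B,
-- and (E3) turns this into A/B ≤ 40 n^(-1/2).

open import Defs
open import Data.Bool using (Bool; true; false; _∧_; _∨_; not; if_then_else_)
open import Data.Bool.Properties using (T-≡; T-not-≡; ∧-assoc; ∧-comm; ∧-identityʳ; ∧-zeroʳ; ∨-comm; ∨-identityʳ; ∨-zeroʳ; ¬-not)
open import Data.Bool.ListAction using (all)
open import Data.Nat using (ℕ; zero; suc; _+_; _*_; _^_; _∸_; _≤_; _<_; z≤n; s≤s; _≡ᵇ_)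
open import Data.Nat.Properties hiding (_≟_)
open import Data.Fin using (Fin; zero; suc)
open import Data.Fin.Properties using (_≟_)
open import Data.Nat.ListAction using () renaming (sum to sumList)
open import Data.List using (List; []; _∷_; _++_; map; concatMap; length; allFin; tabulate; filterᵇ)
open import Data.List.Membership.Propositional.Properties using (∈-allFin)
open import Data.List.Relation.Unary.All as All using ()
open import Data.List.Relation.Unary.All.Properties using (all⁺; all⁻)
open import Data.Vec.Functional using () renaming (_∷_ to _∷ᶠ_)
open import Data.Product using (Σ; _×_; _,_; proj₁; proj₂)
open import Data.Sum using (_⊎_; inj₁; inj₂)
open import Data.Empty using (⊥; ⊥-elim)
open import Function using (_∘_; Equivalence)
open import Relation.Nullary using (¬_; Dec; yes; no; does)
open import Relation.Nullary.Decidable using (dec-true)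
open import Relation.Binary.PropositionalEquality
open import Algebra.Properties.Semiring.Sum +-*-semiring
  using (∑-distrib-+; ∑-comm; *-distribˡ-sum; *-distribʳ-sum; sum-cong-≗; sum-replicate-zero)
  renaming (sum to ∑)
open import Data.Nat.Tactic.RingSolver using (solve-∀)

𝟙 : Bool → ℕ
𝟙 c = if c then 1 else 0

𝟙-∧ : ∀ p q → 𝟙 (p ∧ q) ≡ 𝟙 p * 𝟙 q
𝟙-∧ true q = sym (+-identityʳ (𝟙 q))
𝟙-∧ false q = refl

𝟙-∨-disjoint : ∀ p q → (p ≡ true → q ≡ true → ⊥) → 𝟙 (p ∨ q) ≡ 𝟙 p + 𝟙 q
𝟙-∨-disjoint true true both = ⊥-elim (both refl refl)
𝟙-∨-disjoint true false _ = refl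
𝟙-∨-disjoint false q _ = refl

𝟙-injective : ∀ {p q} → 𝟙 p ≡ 𝟙 q → p ≡ q
𝟙-injective {true} {true} _ = refl
𝟙-injective {false} {false} _ = refl

𝟙*≤ : ∀ c t → 𝟙 c * t ≤ t
𝟙*≤ true t = ≤-reflexive (+-identityʳ t)
𝟙*≤ false t = z≤n

𝟙-all : ∀ p q r s → p ≡ true → q ≡ true → r ≡ true → s ≡ true → 1 ≤ 𝟙 p * (𝟙 q * 𝟙 r) * 𝟙 s
𝟙-all .true .true .true .true refl refl refl refl = s≤s z≤n

false≢true : ∀ {A : Set} → false ≡ true → A
false≢true ()

∧-true : ∀ {p q} → p ∧ q ≡ true → p ≡ true × q ≡ true
∧-true {true} e = refl , e

∨-true : ∀ {p q} → p ∨ q ≡ true → p ≡ true ⊎ q ≡ true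
∨-true {true} _ = inj₁ refl
∨-true {false} e = inj₂ e

_==_ : ∀ {n} → Fin n → Fin n → Bool
i == j = does (i ≟ j)

==-sound : ∀ {n} {i j : Fin n} → i == j ≡ true → i ≡ j
==-sound {i = i} {j} h with i ≟ j
... | yes i≡j = i≡j

==-false : ∀ {n} {i j : Fin n} → i == j ≡ false → ¬ i ≡ j
==-false {i = i} {j} h with i ≟ j
... | no i≢j = i≢j

∑-mono : ∀ {n} {f g : Fin n → ℕ} → (∀ i → f i ≤ g i) → ∑ f ≤ ∑ g
∑-mono {zero} _ = z≤n
∑-mono {suc n} le = +-mono-≤ (le zero) (∑-mono (le ∘ suc))

∑-zero : ∀ {n} (f : Fin n → ℕ) → (∀ i → f i ≡ 0) → ∑ f ≡ 0
∑-zero {n} f e = trans (sum-cong-≗ e) (sum-replicate-zero n)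

∑-δ : ∀ {n} (a : Fin n) (f : Fin n → ℕ) → ∑ (λ i → 𝟙 (i == a) * f i) ≡ f a
∑-δ {suc n} zero f = trans (cong (f zero + 0 +_) (∑-zero {n} (λ _ → 0) (λ _ → refl))) (trans (+-identityʳ _) (+-identityʳ _))
∑-δ (suc a) f = ∑-δ a (f ∘ suc)

∑-tight : ∀ {n} {f g : Fin n → ℕ} → (∀ i → f i ≤ g i) → ∑ f ≡ ∑ g → ∀ i → f i ≡ g i
∑-tight {suc n} {f} {g} le e zero =
  ≤-antisym (le zero) (+-cancelʳ-≤ _ _ _ (≤-trans (≤-reflexive (sym e)) (+-monoʳ-≤ (f zero) (∑-mono (le ∘ suc)))))
∑-tight {suc n} {f} {g} le e (suc i) = ∑-tight (le ∘ suc) tail-eq i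
  where
  tail-eq : ∑ (f ∘ suc) ≡ ∑ (g ∘ suc)
  tail-eq = ≤-antisym (∑-mono (le ∘ suc))
    (+-cancelˡ-≤ (g zero) _ _ (≤-trans (≤-reflexive (sym e)) (+-monoˡ-≤ _ (le zero))))

∑² : ∀ {n} → (Fin n → Fin n → ℕ) → ℕ
∑² f = ∑ λ x → ∑ (f x)

∑²-+ : ∀ {n} (f g : Fin n → Fin n → ℕ) → ∑² (λ x y → f x y + g x y) ≡ ∑² f + ∑² g
∑²-+ f g = trans (sum-cong-≗ (λ x → ∑-distrib-+ (f x) (g x))) (∑-distrib-+ (λ x → ∑ (f x)) (λ x → ∑ (g x)))

∑²-mono : ∀ {n} {f g : Fin n → Fin n → ℕ} → (∀ x y → f x y ≤ g x y) → ∑² f ≤ ∑² g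
∑²-mono le = ∑-mono (λ x → ∑-mono (le x))

∑²-*ˡ : ∀ {n} c (f g : Fin n → ℕ) → ∑² (λ x y → c * (f x * g y)) ≡ c * (∑ f * ∑ g)
∑²-*ˡ c f g = trans (sum-cong-≗ (λ x → sym (*-distribˡ-sum c (λ y → f x * g y))))
  (trans (sym (*-distribˡ-sum c (λ x → ∑ (λ y → f x * g y))))
    (cong (c *_) (trans (sum-cong-≗ (λ x → sym (*-distribˡ-sum (f x) g))) (sym (*-distribʳ-sum (∑ g) f)))))

sum-tabulate : ∀ {A : Set} {n} (g : Fin n → A) (f : A → ℕ) → sumList (map f (tabulate g)) ≡ ∑ (f ∘ g)
sum-tabulate {n = zero} g f = refl
sum-tabulate {n = suc n} g f = cong (f (g zero) +_) (sum-tabulate (g ∘ suc) f)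

sum-allFin : ∀ {n} (f : Fin n → ℕ) → sumList (map f (allFin n)) ≡ ∑ f
sum-allFin f = sum-tabulate (λ i → i) f

deg-as-∑ : ∀ {n} (G : Adj n) w → deg G w ≡ ∑ (λ j → 𝟙 (G w j))
deg-as-∑ G w = sum-allFin (λ j → 𝟙 (G w j))

∑ₗ : ∀ {A : Set} → List A → (A → ℕ) → ℕ
∑ₗ [] f = 0
∑ₗ (x ∷ xs) f = f x + ∑ₗ xs f

∑ₗ-cong : ∀ {A : Set} (xs : List A) {f g : A → ℕ} → (∀ a → f a ≡ g a) → ∑ₗ xs f ≡ ∑ₗ xs g
∑ₗ-cong [] e = refl
∑ₗ-cong (x ∷ xs) e = cong₂ _+_ (e x) (∑ₗ-cong xs e)

∑ₗ-mono : ∀ {A : Set} (xs : List A) {f g : A → ℕ} → (∀ a → f a ≤ g a) → ∑ₗ xs f ≤ ∑ₗ xs g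
∑ₗ-mono [] le = z≤n
∑ₗ-mono (x ∷ xs) le = +-mono-≤ (le x) (∑ₗ-mono xs le)

∑ₗ-zero : ∀ {A : Set} (xs : List A) → ∑ₗ xs (λ _ → 0) ≡ 0
∑ₗ-zero [] = refl
∑ₗ-zero (x ∷ xs) = ∑ₗ-zero xs

∑ₗ-*ˡ : ∀ {A : Set} (xs : List A) c (f : A → ℕ) → ∑ₗ xs (λ a → c * f a) ≡ c * ∑ₗ xs f
∑ₗ-*ˡ [] c f = sym (*-zeroʳ c)
∑ₗ-*ˡ (x ∷ xs) c f = trans (cong (c * f x +_) (∑ₗ-*ˡ xs c f)) (sym (*-distribˡ-+ c (f x) _))

∑ₗ-+ : ∀ {A : Set} (xs : List A) (f g : A → ℕ) → ∑ₗ xs (λ a → f a + g a) ≡ ∑ₗ xs f + ∑ₗ xs g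
∑ₗ-+ [] f g = refl
∑ₗ-+ (x ∷ xs) f g = trans (cong (f x + g x +_) (∑ₗ-+ xs f g)) (+-+-interchange (f x) (g x) _ _)
  where
  +-+-interchange : ∀ a b c d → a + b + (c + d) ≡ a + c + (b + d)
  +-+-interchange = solve-∀

∑ₗ-concatMap : ∀ {A B : Set} (xs : List A) (h : A → List B) f →
  ∑ₗ (concatMap h xs) f ≡ ∑ₗ xs (λ a → ∑ₗ (h a) f)
∑ₗ-concatMap [] h f = refl
∑ₗ-concatMap (x ∷ xs) h f = trans (∑ₗ-++ (h x) _) (cong (∑ₗ (h x) f +_) (∑ₗ-concatMap xs h f))
  where
  ∑ₗ-++ : ∀ ys zs → ∑ₗ (ys ++ zs) f ≡ ∑ₗ ys f + ∑ₗ zs f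
  ∑ₗ-++ [] zs = refl
  ∑ₗ-++ (y ∷ ys) zs = trans (cong (f y +_) (∑ₗ-++ ys zs)) (sym (+-assoc (f y) _ _))

∑ₗ-map : ∀ {A B : Set} (xs : List A) (h : A → B) f → ∑ₗ (map h xs) f ≡ ∑ₗ xs (f ∘ h)
∑ₗ-map [] h f = refl
∑ₗ-map (x ∷ xs) h f = cong (f (h x) +_) (∑ₗ-map xs h f)

∑ₗ-comm : ∀ {A B : Set} (xs : List A) (ys : List B) (f : A → B → ℕ) →
  ∑ₗ xs (λ a → ∑ₗ ys (f a)) ≡ ∑ₗ ys (λ b → ∑ₗ xs (λ a → f a b))
∑ₗ-comm [] ys f = sym (∑ₗ-zero ys)
∑ₗ-comm (x ∷ xs) ys f =
  trans (cong (∑ₗ ys (f x) +_) (∑ₗ-comm xs ys f)) (sym (∑ₗ-+ ys (f x) (λ b → ∑ₗ xs (λ a → f a b))))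

∑ₗ-∑ : ∀ {A : Set} {n} (xs : List A) (f : A → Fin n → ℕ) →
  ∑ₗ xs (λ a → ∑ (f a)) ≡ ∑ (λ i → ∑ₗ xs (λ a → f a i))
∑ₗ-∑ {n = n} [] f = sym (∑-zero {n} (λ _ → 0) (λ _ → refl))
∑ₗ-∑ (x ∷ xs) f =
  trans (cong (∑ (f x) +_) (∑ₗ-∑ xs f)) (sym (∑-distrib-+ (f x) (λ i → ∑ₗ xs (λ a → f a i))))

∑ₗ-∑² : ∀ {A : Set} {n} (xs : List A) (f : A → Fin n → Fin n → ℕ) →
  ∑ₗ xs (λ a → ∑² (f a)) ≡ ∑² (λ x y → ∑ₗ xs (λ a → f a x y))
∑ₗ-∑² xs f = trans (∑ₗ-∑ xs (λ a x → ∑ (f a x))) (sum-cong-≗ (λ x → ∑ₗ-∑ xs (λ a → f a x)))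

length-filter : ∀ {A : Set} (p : A → Bool) xs → length (filterᵇ p xs) ≡ ∑ₗ xs (𝟙 ∘ p)
length-filter p [] = refl
length-filter p (x ∷ xs) with p x
... | true = cong suc (length-filter p xs)
... | false = length-filter p xs

switching-inequality : ∀ {A B : Set} (xs : List A) (ys : List B) (w : A → B → ℕ)
  (p : A → Bool) (q : B → Bool) (lo hi : ℕ) →
  (∀ a → p a ≡ true → lo ≤ ∑ₗ ys (w a)) →
  (∀ b → ∑ₗ xs (λ a → w a b) ≤ hi * 𝟙 (q b)) →
  lo * ∑ₗ xs (𝟙 ∘ p) ≤ hi * ∑ₗ ys (𝟙 ∘ q)
switching-inequality xs ys w p q lo hi outgoing incoming = begin
  lo * ∑ₗ xs (𝟙 ∘ p)                 ≡⟨ ∑ₗ-*ˡ xs lo (𝟙 ∘ p) ⟨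
  ∑ₗ xs (λ a → lo * 𝟙 (p a))         ≤⟨ ∑ₗ-mono xs outgoing′ ⟩
  ∑ₗ xs (λ a → ∑ₗ ys (w a))          ≡⟨ ∑ₗ-comm xs ys w ⟩
  ∑ₗ ys (λ b → ∑ₗ xs (λ a → w a b))  ≤⟨ ∑ₗ-mono ys incoming ⟩
  ∑ₗ ys (λ b → hi * 𝟙 (q b))         ≡⟨ ∑ₗ-*ˡ ys hi (𝟙 ∘ q) ⟩
  hi * ∑ₗ ys (𝟙 ∘ q)                 ∎
  where
  open ≤-Reasoning
  outgoing′ : ∀ a → lo * 𝟙 (p a) ≤ ∑ₗ ys (w a)
  outgoing′ a with p a in pa
  ... | true = ≤-trans (≤-reflexive (*-identityʳ lo)) (outgoing a pa)
  ... | false = ≤-trans (≤-reflexive (*-zeroʳ lo)) z≤n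

-- Boolean pointwise agreement of two functions on Fin n (recursing like `funs`).
agreeᵇ : ∀ {A : Set} {n} → (A → A → Bool) → (Fin n → A) → (Fin n → A) → Bool
agreeᵇ {n = zero} e f g = true
agreeᵇ {n = suc n} e f g = e (f zero) (g zero) ∧ agreeᵇ e (f ∘ suc) (g ∘ suc)

agreeᵇ-sound : ∀ {A : Set} {n} (e : A → A → Bool) (f g : Fin n → A) →
  agreeᵇ e f g ≡ true → ∀ i → e (f i) (g i) ≡ true
agreeᵇ-sound e f g h zero = proj₁ (∧-true h)
agreeᵇ-sound e f g h (suc i) = agreeᵇ-sound e (f ∘ suc) (g ∘ suc) (proj₂ (∧-true h)) i

agreeᵇ-complete : ∀ {A : Set} {n} (e : A → A → Bool) (f g : Fin n → A) →
  (∀ i → e (f i) (g i) ≡ true) → agreeᵇ e f g ≡ true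
agreeᵇ-complete {n = zero} e f g h = refl
agreeᵇ-complete {n = suc n} e f g h
  rewrite h zero = agreeᵇ-complete e (f ∘ suc) (g ∘ suc) (h ∘ suc)

funs-unique : ∀ {A : Set} (e : A → A → Bool) (xs : List A) →
  (∀ a → ∑ₗ xs (λ x → 𝟙 (e x a)) ≡ 1) →
  ∀ n (g : Fin n → A) → ∑ₗ (funs xs n) (λ f → 𝟙 (agreeᵇ e f g)) ≡ 1
funs-unique e xs once zero g = refl
funs-unique e xs once (suc n) g = begin
  ∑ₗ (funs xs (suc n)) (λ f → 𝟙 (agreeᵇ e f g))
    ≡⟨ ∑ₗ-concatMap xs (λ x → map (x ∷ᶠ_) (funs xs n)) _ ⟩
  ∑ₗ xs (λ x → ∑ₗ (map (x ∷ᶠ_) (funs xs n)) (λ f → 𝟙 (agreeᵇ e f g)))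
    ≡⟨ ∑ₗ-cong xs head-factor ⟩
  ∑ₗ xs (λ x → 𝟙 (e x (g zero)))
    ≡⟨ once (g zero) ⟩
  1 ∎
  where
  open ≡-Reasoning
  head-factor : ∀ x → ∑ₗ (map (x ∷ᶠ_) (funs xs n)) (λ f → 𝟙 (agreeᵇ e f g)) ≡ 𝟙 (e x (g zero))
  head-factor x = begin
    ∑ₗ (map (x ∷ᶠ_) (funs xs n)) (λ f → 𝟙 (agreeᵇ e f g))
      ≡⟨ ∑ₗ-map (funs xs n) (x ∷ᶠ_) _ ⟩
    ∑ₗ (funs xs n) (λ f → 𝟙 (e x (g zero) ∧ agreeᵇ e f (g ∘ suc)))
      ≡⟨ ∑ₗ-cong (funs xs n) (λ f → 𝟙-∧ (e x (g zero)) (agreeᵇ e f (g ∘ suc))) ⟩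
    ∑ₗ (funs xs n) (λ f → 𝟙 (e x (g zero)) * 𝟙 (agreeᵇ e f (g ∘ suc)))
      ≡⟨ ∑ₗ-*ˡ (funs xs n) (𝟙 (e x (g zero))) _ ⟩
    𝟙 (e x (g zero)) * ∑ₗ (funs xs n) (λ f → 𝟙 (agreeᵇ e f (g ∘ suc)))
      ≡⟨ cong (𝟙 (e x (g zero)) *_) (funs-unique e xs once n (g ∘ suc)) ⟩
    𝟙 (e x (g zero)) * 1
      ≡⟨ *-identityʳ _ ⟩
    𝟙 (e x (g zero)) ∎

==ᵇ-sound : ∀ {a c} → (a ==ᵇ c) ≡ true → a ≡ c
==ᵇ-sound {true} {true} _ = refl
==ᵇ-sound {false} {false} _ = refl

==ᵇ-refl : ∀ a → (a ==ᵇ a) ≡ true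
==ᵇ-refl true = refl
==ᵇ-refl false = refl

==ᵇ-complete : ∀ {a c} → a ≡ c → (a ==ᵇ c) ≡ true
==ᵇ-complete {a} refl = ==ᵇ-refl a

sameAdj : ∀ {n} → Adj n → Adj n → Bool
sameAdj = agreeᵇ (agreeᵇ _==ᵇ_)

sameAdj-sound : ∀ {n} {K G : Adj n} → sameAdj K G ≡ true → ∀ i j → K i j ≡ G i j
sameAdj-sound {K = K} {G} h i j =
  ==ᵇ-sound (agreeᵇ-sound _==ᵇ_ (K i) (G i) (agreeᵇ-sound (agreeᵇ _==ᵇ_) K G h i) j)

sameAdj-complete : ∀ {n} {K G : Adj n} → (∀ i j → K i j ≡ G i j) → sameAdj K G ≡ true
sameAdj-complete {K = K} {G} h = agreeᵇ-complete (agreeᵇ _==ᵇ_) K G (λ i →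
  agreeᵇ-complete _==ᵇ_ (K i) (G i) (==ᵇ-complete ∘ h i))

allAdj-unique : ∀ n (G : Adj n) → ∑ₗ (allAdj n) (λ K → 𝟙 (sameAdj K G)) ≡ 1
allAdj-unique n = funs-unique (agreeᵇ _==ᵇ_) (funs (true ∷ false ∷ []) n)
  (funs-unique _==ᵇ_ (true ∷ false ∷ []) bool-once n) n
  where
  bool-once : ∀ a → ∑ₗ (true ∷ false ∷ []) (λ x → 𝟙 (x ==ᵇ a)) ≡ 1
  bool-once true = refl
  bool-once false = refl

all-sound : ∀ {n} (p : Fin n → Bool) → all p (allFin n) ≡ true → ∀ i → p i ≡ true
all-sound p h i =
  Equivalence.to T-≡ (All.lookup (all⁺ p (allFin _) (Equivalence.from T-≡ h)) (∈-allFin i))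

all-complete : ∀ {n} (p : Fin n → Bool) → (∀ i → p i ≡ true) → all p (allFin n) ≡ true
all-complete {n} p h = Equivalence.to T-≡ (all⁻ p {allFin n} (All.tabulate (λ {i} _ → Equivalence.from T-≡ (h i))))

allPairs-sound : ∀ {n} (p : Fin n → Fin n → Bool) → allPairs p ≡ true → ∀ i j → p i j ≡ true
allPairs-sound p h i = all-sound (p i) (all-sound _ h i)

allPairs-complete : ∀ {n} (p : Fin n → Fin n → Bool) → (∀ i j → p i j ≡ true) → allPairs p ≡ true
allPairs-complete p h = all-complete _ (λ i → all-complete (p i) (h i))

⇒ᵇ-sound : ∀ {a c} → (a ⇒ᵇ c) ≡ true → a ≡ true → c ≡ true
⇒ᵇ-sound {true} h refl = h

⇒ᵇ-complete : ∀ {a c} → (a ≡ true → c ≡ true) → (a ⇒ᵇ c) ≡ true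
⇒ᵇ-complete {true} h = h refl
⇒ᵇ-complete {false} h = refl

module Conditioning {n : ℕ} (d : Fin n → ℕ) (Z : Subset n) (H F : Adj n) where

  admissibleᵇ : Adj n → Bool
  admissibleᵇ G = isSimpleᵇ G ∧ hasDegreesᵇ G d ∧ inducedEqᵇ G Z H ∧ subgraphᵇ F G

  record Admissible (G : Adj n) : Set where
    field
      loopless  : ∀ i → G i i ≡ false
      symmetric : ∀ i j → G i j ≡ G j i
      degrees   : ∀ w → deg G w ≡ d w
      induces   : ∀ i j → Z i ≡ true → Z j ≡ true → G i j ≡ H i j
      contains  : ∀ i j → F i j ≡ true → G i j ≡ true

  admissible-sound : ∀ {G} → admissibleᵇ G ≡ true → Admissible G
  admissible-sound {G} h = record
    { loopless  = λ i → Equivalence.to T-not-≡ (Equivalence.from T-≡ (all-sound (λ i → not (G i i)) loops i))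
    ; symmetric = λ i j → ==ᵇ-sound (allPairs-sound (λ i j → G i j ==ᵇ G j i) symm i j)
    ; degrees   = λ w → ≡ᵇ⇒≡ _ _ (Equivalence.from T-≡ (all-sound (λ w → deg G w ≡ᵇ d w) degs w))
    ; induces   = λ i j zi zj →
        ==ᵇ-sound (⇒ᵇ-sound (allPairs-sound (λ i j → (Z i ∧ Z j) ⇒ᵇ (G i j ==ᵇ H i j)) ind i j) (cong₂ _∧_ zi zj))
    ; contains  = λ i j → ⇒ᵇ-sound (allPairs-sound (λ i j → F i j ⇒ᵇ G i j) sub i j)
    }
    where
    simple : isSimpleᵇ G ≡ true
    simple = proj₁ (∧-true {isSimpleᵇ G} h)
    rest : hasDegreesᵇ G d ∧ inducedEqᵇ G Z H ∧ subgraphᵇ F G ≡ true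
    rest = proj₂ (∧-true {isSimpleᵇ G} h)
    loops : all (λ i → not (G i i)) (allFin n) ≡ true
    loops = proj₁ (∧-true {all (λ i → not (G i i)) (allFin n)} simple)
    symm : allPairs (λ i j → G i j ==ᵇ G j i) ≡ true
    symm = proj₂ (∧-true {all (λ i → not (G i i)) (allFin n)} simple)
    degs : hasDegreesᵇ G d ≡ true
    degs = proj₁ (∧-true {hasDegreesᵇ G d} rest)
    ind : inducedEqᵇ G Z H ≡ true
    ind = proj₁ (∧-true {inducedEqᵇ G Z H} (proj₂ (∧-true {hasDegreesᵇ G d} rest)))
    sub : subgraphᵇ F G ≡ true
    sub = proj₂ (∧-true {inducedEqᵇ G Z H} (proj₂ (∧-true {hasDegreesᵇ G d} rest)))

  admissible-complete : ∀ {G} → Admissible G → admissibleᵇ G ≡ true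
  admissible-complete {G} a =
    cong₂ _∧_ (cong₂ _∧_ loopless′ symmetric′) (cong₂ _∧_ degrees′ (cong₂ _∧_ induces′ contains′))
    where
    open Admissible a
    loopless′ : all (λ i → not (G i i)) (allFin n) ≡ true
    loopless′ = all-complete (λ i → not (G i i)) (λ i → cong not (loopless i))
    symmetric′ : allPairs (λ i j → G i j ==ᵇ G j i) ≡ true
    symmetric′ = allPairs-complete (λ i j → G i j ==ᵇ G j i) (λ i j → ==ᵇ-complete (symmetric i j))
    degrees′ : hasDegreesᵇ G d ≡ true
    degrees′ = all-complete (λ w → deg G w ≡ᵇ d w) (λ w → Equivalence.to T-≡ (≡⇒≡ᵇ _ _ (degrees w)))
    induces′ : inducedEqᵇ G Z H ≡ true
    induces′ = allPairs-complete (λ i j → (Z i ∧ Z j) ⇒ᵇ (G i j ==ᵇ H i j)) λ i j → ⇒ᵇ-complete λ zij →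
      ==ᵇ-complete (induces i j (proj₁ (∧-true zij)) (proj₂ (∧-true zij)))
    contains′ : subgraphᵇ F G ≡ true
    contains′ = allPairs-complete (λ i j → F i j ⇒ᵇ G i j) (λ i j → ⇒ᵇ-complete (contains i j))

  admissible-transfer : ∀ {G K} → (∀ i j → G i j ≡ K i j) → Admissible G → Admissible K
  admissible-transfer {G} {K} G≗K adm = record
    { loopless  = λ i → trans (sym (G≗K i i)) (loopless i)
    ; symmetric = λ i j → trans (sym (G≗K i j)) (trans (symmetric i j) (G≗K j i))
    ; degrees   = λ w → trans (sym (same-degree w)) (degrees w)
    ; induces   = λ i j zi zj → trans (sym (G≗K i j)) (induces i j zi zj)
    ; contains  = λ i j ij∈F → trans (sym (G≗K i j)) (contains i j ij∈F)
    }
    where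
    open Admissible adm
    same-degree : ∀ w → deg G w ≡ deg K w
    same-degree w = trans (deg-as-∑ G w) (trans (sum-cong-≗ (λ j → cong 𝟙 (G≗K w j))) (sym (deg-as-∑ K w)))

edge : ∀ {n} → Fin n → Fin n → Adj n
edge a c i j = (i == a ∧ j == c) ∨ (i == c ∧ j == a)

edge-sound : ∀ {n} {a c i j : Fin n} → edge a c i j ≡ true → (i ≡ a × j ≡ c) ⊎ (i ≡ c × j ≡ a)
edge-sound {a = a} {c} {i} {j} h with ∨-true {i == a ∧ j == c} h
... | inj₁ e = inj₁ (==-sound (proj₁ (∧-true e)) , ==-sound (proj₂ (∧-true {i == a} e)))
... | inj₂ e = inj₂ (==-sound (proj₁ (∧-true e)) , ==-sound (proj₂ (∧-true {i == c} e)))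

edge-absent : ∀ {n} {a c i j : Fin n} → ¬ (edge a c i j ≡ true) → edge a c i j ≡ false
edge-absent = ¬-not

edge-present : ∀ {n} (a c : Fin n) → edge a c a c ≡ true
edge-present a c rewrite dec-true (a ≟ a) refl | dec-true (c ≟ c) refl = refl

edge-flip : ∀ {n} (a c i j : Fin n) → edge a c i j ≡ edge a c j i
edge-flip a c i j with i == a | j == c | i == c | j == a
... | p | q | r | s = trans (∨-comm (p ∧ q) (r ∧ s))
                        (cong₂ _∨_ (∧-comm r s) (∧-comm p q))

edge-swap : ∀ {n} (a c i j : Fin n) → edge a c i j ≡ edge c a i j
edge-swap a c i j = ∨-comm (i == a ∧ j == c) (i == c ∧ j == a)

edge-elim : ∀ {n} (P : Fin n → Fin n → Set) {a c i j : Fin n} → P a c → P c a → edge a c i j ≡ true → P i j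
edge-elim P {a} {c} {i} {j} Pac Pca h with edge-sound {a = a} {c} {i} {j} h
... | inj₁ (refl , refl) = Pac
... | inj₂ (refl , refl) = Pca

edge-distinct : ∀ {n} {a c a′ c′ i j : Fin n} → ¬ a ≡ a′ → ¬ a ≡ c′ →
  edge a c i j ≡ true → edge a′ c′ i j ≡ true → ⊥
edge-distinct {a = a} {c} {a′} {c′} {i} {j} a≢a′ a≢c′ h h′
  with edge-sound {a = a} {c} {i} {j} h | edge-sound {a = a′} {c′} {i} {j} h′
... | inj₁ (i≡a , _) | inj₁ (i≡a′ , _) = a≢a′ (trans (sym i≡a) i≡a′)
... | inj₁ (i≡a , _) | inj₂ (i≡c′ , _) = a≢c′ (trans (sym i≡a) i≡c′)
... | inj₂ (_ , j≡a) | inj₁ (_ , j≡c′) = a≢c′ (trans (sym j≡a) j≡c′)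
... | inj₂ (_ , j≡a) | inj₂ (_ , j≡a′) = a≢a′ (trans (sym j≡a) j≡a′)

edge-loop : ∀ {n} {a c : Fin n} → ¬ a ≡ c → ∀ i → edge a c i i ≡ false
edge-loop {a = a} {c} a≢c i = edge-absent {a = a} {c} {i} {i} λ h →
  edge-elim (λ i j → ¬ i ≡ j) {a} {c} {i} {i} a≢c (a≢c ∘ sym) h refl

edge-outside : ∀ {n} (Z : Subset n) {a c i j : Fin n} → Z a ≡ false → Z i ≡ true → Z j ≡ true →
  edge a c i j ≡ false
edge-outside Z {a} {c} {i} {j} a∉Z i∈Z j∈Z = edge-absent {a = a} {c} {i} {j} λ h →
  edge-elim (λ i j → Z i ≡ true → Z j ≡ true → ⊥) {a} {c} {i} {j}
    (λ a∈Z _ → false≢true (trans (sym a∉Z) a∈Z)) (λ _ a∈Z → false≢true (trans (sym a∉Z) a∈Z)) h i∈Z j∈Z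

edge-degree : ∀ {n} {a c : Fin n} → ¬ a ≡ c → ∀ w → ∑ (λ j → 𝟙 (edge a c w j)) ≡ 𝟙 (w == a) + 𝟙 (w == c)
edge-degree {n} {a} {c} a≢c w = begin
  ∑ (λ j → 𝟙 (edge a c w j))
    ≡⟨ sum-cong-≗ split ⟩
  ∑ (λ j → 𝟙 (w == a) * 𝟙 (j == c) + 𝟙 (w == c) * 𝟙 (j == a))
    ≡⟨ ∑-distrib-+ (λ j → 𝟙 (w == a) * 𝟙 (j == c)) (λ j → 𝟙 (w == c) * 𝟙 (j == a)) ⟩
  ∑ (λ j → 𝟙 (w == a) * 𝟙 (j == c)) + ∑ (λ j → 𝟙 (w == c) * 𝟙 (j == a))
    ≡⟨ cong₂ _+_ (*-distribˡ-sum (𝟙 (w == a)) (λ j → 𝟙 (j == c))) (*-distribˡ-sum (𝟙 (w == c)) (λ j → 𝟙 (j == a))) ⟨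
  𝟙 (w == a) * ∑ (λ j → 𝟙 (j == c)) + 𝟙 (w == c) * ∑ (λ j → 𝟙 (j == a))
    ≡⟨ cong₂ _+_ (cong (𝟙 (w == a) *_) (count-one c)) (cong (𝟙 (w == c) *_) (count-one a)) ⟩
  𝟙 (w == a) * 1 + 𝟙 (w == c) * 1
    ≡⟨ cong₂ _+_ (*-identityʳ (𝟙 (w == a))) (*-identityʳ (𝟙 (w == c))) ⟩
  𝟙 (w == a) + 𝟙 (w == c) ∎
  where
  open ≡-Reasoning
  count-one : ∀ t → ∑ (λ j → 𝟙 (j == t)) ≡ 1
  count-one t = trans (sum-cong-≗ (λ j → sym (*-identityʳ (𝟙 (j == t))))) (∑-δ t (λ _ → 1))
  split : ∀ j → 𝟙 (edge a c w j) ≡ 𝟙 (w == a) * 𝟙 (j == c) + 𝟙 (w == c) * 𝟙 (j == a)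
  split j = trans (𝟙-∨-disjoint (w == a ∧ j == c) (w == c ∧ j == a) not-both)
                  (cong₂ _+_ (𝟙-∧ (w == a) (j == c)) (𝟙-∧ (w == c) (j == a)))
    where
    not-both : w == a ∧ j == c ≡ true → w == c ∧ j == a ≡ true → ⊥
    not-both h₁ h₂ = a≢c (trans (sym (==-sound {i = w} (proj₁ (∧-true h₁)))) (==-sound {i = w} (proj₁ (∧-true h₂))))

-- Replacing the edges e₁, e₂ of a graph by the non-edges f₁, f₂; first at a
-- single position (g, p₁, p₂, q₁, q₂ are the entries of G, e₁, e₂, f₁, f₂).
replaceᵇ : Bool → Bool → Bool → Bool → Bool → Bool
replaceᵇ g p₁ p₂ q₁ q₂ = (g ∧ not p₁ ∧ not p₂) ∨ (q₁ ∨ q₂)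

replace : ∀ {n} → (e₁ e₂ f₁ f₂ : Adj n) → Adj n → Adj n
replace e₁ e₂ f₁ f₂ G i j = replaceᵇ (G i j) (e₁ i j) (e₂ i j) (f₁ i j) (f₂ i j)

record Switching {n} (G e₁ e₂ f₁ f₂ : Adj n) : Set where
  field
    e₁∈G : ∀ i j → e₁ i j ≡ true → G i j ≡ true
    e₂∈G : ∀ i j → e₂ i j ≡ true → G i j ≡ true
    f₁∉G : ∀ i j → f₁ i j ≡ true → G i j ≡ false
    f₂∉G : ∀ i j → f₂ i j ≡ true → G i j ≡ false
    e-distinct : ∀ i j → e₁ i j ≡ true → e₂ i j ≡ true → ⊥
    f-distinct : ∀ i j → f₁ i j ≡ true → f₂ i j ≡ true → ⊥

replaceᵇ-count : ∀ g p₁ p₂ q₁ q₂ → (p₁ ≡ true → g ≡ true) → (p₂ ≡ true → g ≡ true) →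
  (q₁ ≡ true → g ≡ false) → (q₂ ≡ true → g ≡ false) →
  (p₁ ≡ true → p₂ ≡ true → ⊥) → (q₁ ≡ true → q₂ ≡ true → ⊥) →
  𝟙 (replaceᵇ g p₁ p₂ q₁ q₂) + 𝟙 p₁ + 𝟙 p₂ ≡ 𝟙 g + 𝟙 q₁ + 𝟙 q₂
replaceᵇ-count true p₁ p₂ true q₂ _ _ q₁∉ _ _ _ = false≢true (sym (q₁∉ refl))
replaceᵇ-count true p₁ p₂ false true _ _ _ q₂∉ _ _ = false≢true (sym (q₂∉ refl))
replaceᵇ-count true true true false false _ _ _ _ p-dist _ = ⊥-elim (p-dist refl refl)
replaceᵇ-count true true false false false _ _ _ _ _ _ = refl
replaceᵇ-count true false true false false _ _ _ _ _ _ = refl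
replaceᵇ-count true false false false false _ _ _ _ _ _ = refl
replaceᵇ-count false true p₂ q₁ q₂ p₁∈ _ _ _ _ _ = false≢true (p₁∈ refl)
replaceᵇ-count false false true q₁ q₂ _ p₂∈ _ _ _ _ = false≢true (p₂∈ refl)
replaceᵇ-count false false false true true _ _ _ _ _ q-dist = ⊥-elim (q-dist refl refl)
replaceᵇ-count false false false true false _ _ _ _ _ _ = refl
replaceᵇ-count false false false false true _ _ _ _ _ _ = refl
replaceᵇ-count false false false false false _ _ _ _ _ _ = refl

replaceᵇ-undo : ∀ g p₁ p₂ q₁ q₂ → (p₁ ≡ true → g ≡ true) → (p₂ ≡ true → g ≡ true) →
  (q₁ ≡ true → g ≡ false) → (q₂ ≡ true → g ≡ false) →
  replaceᵇ (replaceᵇ g p₁ p₂ q₁ q₂) q₁ q₂ p₁ p₂ ≡ g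
replaceᵇ-undo true p₁ p₂ true q₂ _ _ q₁∉ _ = false≢true (sym (q₁∉ refl))
replaceᵇ-undo true p₁ p₂ false true _ _ _ q₂∉ = false≢true (sym (q₂∉ refl))
replaceᵇ-undo true true p₂ false false _ _ _ _ = refl
replaceᵇ-undo true false true false false _ _ _ _ = refl
replaceᵇ-undo true false false false false _ _ _ _ = refl
replaceᵇ-undo false true p₂ q₁ q₂ p₁∈ _ _ _ = false≢true (p₁∈ refl)
replaceᵇ-undo false false true q₁ q₂ _ p₂∈ _ _ = false≢true (p₂∈ refl)
replaceᵇ-undo false false false true q₂ _ _ _ _ = refl
replaceᵇ-undo false false false false true _ _ _ _ = refl
replaceᵇ-undo false false false false false _ _ _ _ = refl

module _ {n} {G e₁ e₂ f₁ f₂ : Adj n} (s : Switching G e₁ e₂ f₁ f₂) where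
  open Switching s

  switching-undo : ∀ i j → replace f₁ f₂ e₁ e₂ (replace e₁ e₂ f₁ f₂ G) i j ≡ G i j
  switching-undo i j = replaceᵇ-undo (G i j) (e₁ i j) (e₂ i j) (f₁ i j) (f₂ i j)
    (e₁∈G i j) (e₂∈G i j) (f₁∉G i j) (f₂∉G i j)

  switching-degree : ∀ w →
    ∑ (λ j → 𝟙 (e₁ w j)) + ∑ (λ j → 𝟙 (e₂ w j)) ≡ ∑ (λ j → 𝟙 (f₁ w j)) + ∑ (λ j → 𝟙 (f₂ w j)) →
    deg (replace e₁ e₂ f₁ f₂ G) w ≡ deg G w
  switching-degree w balance = +-cancelʳ-≡ _ (deg R w) (deg G w) (begin
    deg R w + (E₁ + E₂)
      ≡⟨ cong (_+ (E₁ + E₂)) (deg-as-∑ R w) ⟩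
    ∑ (λ j → 𝟙 (R w j)) + (E₁ + E₂)
      ≡⟨ ∑-+₃ (λ j → 𝟙 (R w j)) (λ j → 𝟙 (e₁ w j)) (λ j → 𝟙 (e₂ w j)) ⟨
    ∑ (λ j → 𝟙 (R w j) + 𝟙 (e₁ w j) + 𝟙 (e₂ w j))
      ≡⟨ sum-cong-≗ pointwise ⟩
    ∑ (λ j → 𝟙 (G w j) + 𝟙 (f₁ w j) + 𝟙 (f₂ w j))
      ≡⟨ ∑-+₃ (λ j → 𝟙 (G w j)) (λ j → 𝟙 (f₁ w j)) (λ j → 𝟙 (f₂ w j)) ⟩
    ∑ (λ j → 𝟙 (G w j)) + (∑ (λ j → 𝟙 (f₁ w j)) + ∑ (λ j → 𝟙 (f₂ w j)))
      ≡⟨ cong₂ _+_ (deg-as-∑ G w) balance ⟨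
    deg G w + (E₁ + E₂) ∎)
    where
    open ≡-Reasoning
    R : Adj n
    R = replace e₁ e₂ f₁ f₂ G
    E₁ E₂ : ℕ
    E₁ = ∑ (λ j → 𝟙 (e₁ w j))
    E₂ = ∑ (λ j → 𝟙 (e₂ w j))
    ∑-+₃ : ∀ (f g h : Fin n → ℕ) → ∑ (λ j → f j + g j + h j) ≡ ∑ f + (∑ g + ∑ h)
    ∑-+₃ f g h = trans (∑-distrib-+ (λ j → f j + g j) h)
      (trans (cong (_+ ∑ h) (∑-distrib-+ f g)) (+-assoc (∑ f) _ _))
    pointwise : ∀ j → 𝟙 (R w j) + 𝟙 (e₁ w j) + 𝟙 (e₂ w j) ≡ 𝟙 (G w j) + 𝟙 (f₁ w j) + 𝟙 (f₂ w j)
    pointwise j = replaceᵇ-count (G w j) (e₁ w j) (e₂ w j) (f₁ w j) (f₂ w j)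
      (e₁∈G w j) (e₂∈G w j) (f₁∉G w j) (f₂∉G w j) (e-distinct w j) (f-distinct w j)

largest : ∀ {P : ℕ → Set} → (∀ m → Dec (P m)) → ∀ N → P 0 → (∀ m → P m → m ≤ N) →
  Σ ℕ λ K → P K × (∀ m → P m → m ≤ K)
largest P? zero P0 bounded = 0 , P0 , bounded
largest {P} P? (suc N) P0 bounded with P? (suc N)
... | yes PN = suc N , PN , bounded
... | no ¬PN = largest P? N P0 λ m Pm →
  m<1+n⇒m≤n (≤∧≢⇒< (bounded m Pm) (λ m≡N → ¬PN (subst P m≡N Pm)))

fourth-root : ∀ n → Σ ℕ λ K → K ^ 4 ≤ n × (∀ m → m ^ 4 ≤ n → m ≤ K)
fourth-root n = largest (λ m → m ^ 4 ≤? n) n z≤n (λ m m⁴≤n → ≤-trans (m≤m⁴ m) m⁴≤n)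
  where
  m≤m⁴ : ∀ m → m ≤ m ^ 4
  m≤m⁴ zero = z≤n
  m≤m⁴ m@(suc _) = m≤m*n m (m ^ 3) {{m^n≢0 m 3}}

-- Ring identities for the final estimate; powers appear unfolded
-- (K ^ 4 is K * (K * (K * (K * 1)))) so that the ring solver can prove them.
K⁴ : ∀ K → K * K * (K * K) ≡ K * (K * (K * (K * 1)))
K⁴ = solve-∀

regroup : ∀ A r → A * (20 * (2 * r)) ≡ 40 * (r * A)
regroup = solve-∀

square-* : ∀ A n → A * (A * 1) * n * n ≡ (A * n) * (A * n)
square-* = solve-∀

square-40 : ∀ K B → (40 * (K * K * B)) * (40 * (K * K * B)) ≡ 1600 * (B * (B * 1)) * (K * (K * (K * (K * 1))))
square-40 = solve-∀

square-bound : ∀ n K → 25600 ≤ n → K ^ 4 ≤ n → 160 * (K * K) ≤ n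
square-bound n K n-large K⁴≤n with K * K ≤? 160
... | yes K²≤160 = ≤-trans (*-monoʳ-≤ 160 K²≤160) (≤-trans (≤ᵇ⇒≤ 25600 25600 _) n-large)
... | no K²≰160 = ≤-trans (*-monoˡ-≤ (K * K) (<⇒≤ (≰⇒> K²≰160))) (≤-trans (≤-reflexive (K⁴ K)) K⁴≤n)

-- The arithmetic turning the switching inequality (s ∸ 4K²)·A ≤ K²·B, with
-- s ≥ n/20 and K⁴ ≤ n, into A/B ≤ 40 n^(-1/2), squared to stay in ℕ.
ratio-bound : ∀ n s K A B → 25600 ≤ n → K ^ 4 ≤ n → n ≤ 20 * s →
  (s ∸ 4 * (K * K)) * A ≤ K * K * B → A ^ 2 * n ≤ 1600 * B ^ 2
ratio-bound n@(suc _) s K A B n-large K⁴≤n n≤20s switching =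
  *-cancelʳ-≤ (A ^ 2 * n) (1600 * B ^ 2) n (begin
    A ^ 2 * n * n                ≡⟨ square-* A n ⟩
    (A * n) * (A * n)            ≤⟨ *-mono-≤ An≤40K²B An≤40K²B ⟩
    (40 * (K * K * B)) * (40 * (K * K * B)) ≡⟨ square-40 K B ⟩
    1600 * B ^ 2 * K ^ 4         ≤⟨ *-monoʳ-≤ (1600 * B ^ 2) K⁴≤n ⟩
    1600 * B ^ 2 * n             ∎)
  where
  open ≤-Reasoning
  K² r : ℕ
  K² = K * K
  r = s ∸ 4 * K²
  -- 160 K² ≤ n ≤ 20 s gives 8 K² ≤ s, hence s ≤ 2 (s ∸ 4 K²).
  8K²≤s : 8 * K² ≤ s
  8K²≤s = *-cancelˡ-≤ 20 (≤-trans (≤-reflexive (sym (*-assoc 20 8 K²))) (≤-trans (square-bound n K n-large K⁴≤n) n≤20s))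
  4K²≤r : 4 * K² ≤ r
  4K²≤r = begin
    4 * K²                  ≡⟨ m+n∸n≡m (4 * K²) (4 * K²) ⟨
    4 * K² + 4 * K² ∸ 4 * K² ≡⟨ cong (_∸ 4 * K²) (*-distribʳ-+ K² 4 4) ⟨
    8 * K² ∸ 4 * K²         ≤⟨ ∸-monoˡ-≤ (4 * K²) 8K²≤s ⟩
    r                       ∎
  s≤2r : s ≤ 2 * r
  s≤2r = begin
    s              ≡⟨ m∸n+n≡m (≤-trans 4K²≤r (m∸n≤m s (4 * K²))) ⟨
    r + 4 * K²     ≤⟨ +-monoʳ-≤ r 4K²≤r ⟩
    r + r          ≡⟨ cong (r +_) (+-identityʳ r) ⟨
    2 * r          ∎
  An≤40K²B : A * n ≤ 40 * (K * K * B)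
  An≤40K²B = begin
    A * n          ≤⟨ *-monoʳ-≤ A n≤20s ⟩
    A * (20 * s)   ≤⟨ *-monoʳ-≤ A (*-monoʳ-≤ 20 s≤2r) ⟩
    A * (20 * (2 * r)) ≡⟨ regroup A r ⟩
    40 * (r * A)   ≤⟨ *-monoʳ-≤ 40 switching ⟩
    40 * (K * K * B) ∎

-- Truth table behind the count of valid positions: a position with x ∉ Z
-- and xy ∈ G ∖ F is valid unless ux ∈ G, vy ∈ G, x = u or y = v.
valid-or-invalid : ∀ g z f p q r s → 𝟙 (not z) * 𝟙 (g ∧ not f) ≤
  𝟙 (g ∧ not z ∧ not f ∧ not p ∧ not q ∧ not r ∧ not s) +
  (𝟙 p * (𝟙 (not z) * 𝟙 g) + 𝟙 q * (𝟙 (not z) * 𝟙 g) + 𝟙 r * 𝟙 g + 𝟙 s * 𝟙 g)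
valid-or-invalid g true f p q r s = z≤n
valid-or-invalid false false f p q r s = z≤n
valid-or-invalid true false true p q r s = z≤n
valid-or-invalid true false false false false false false = s≤s z≤n
valid-or-invalid true false false false false false true = s≤s z≤n
valid-or-invalid true false false false false true s = s≤s z≤n
valid-or-invalid true false false false true r s = s≤s z≤n
valid-or-invalid true false false true q r s = s≤s z≤n

module Setting {n : ℕ} (Z : Subset n) (H F : Adj n) (u v : Fin n) (d : Fin n → ℕ)
  (H-on-Z : OnVertexSet H Z) (F-simple : IsSimple F) (v∉Z : Z v ≡ false) (uv∉F : F u v ≡ false)
  (E1 : d u ^ 4 ≤ n) (E2 : ∀ w → n < d w ^ 4 → Z w ≡ true × d w ≡ deg H w) where

  open Conditioning d Z H F

  K : ℕ
  K = proj₁ (fourth-root n)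

  K⁴≤n : K ^ 4 ≤ n
  K⁴≤n = proj₁ (proj₂ (fourth-root n))

  small⇒≤K : ∀ w → d w ^ 4 ≤ n → d w ≤ K
  small⇒≤K w = proj₂ (proj₂ (fourth-root n)) (d w)

  outside⇒≤K : ∀ w → Z w ≡ false → d w ≤ K
  outside⇒≤K w w∉Z with d w ^ 4 ≤? n
  ... | yes small = small⇒≤K w small
  ... | no large = false≢true (trans (sym w∉Z) (proj₁ (E2 w (≰⇒> large))))

  du≤K : d u ≤ K
  du≤K = small⇒≤K u E1

  dv≤K : d v ≤ K
  dv≤K = outside⇒≤K v v∉Z

  validᵇ : Adj n → Fin n → Fin n → Bool
  validᵇ G x y = G x y ∧ not (Z x) ∧ not (F x y) ∧ not (G u x) ∧ not (G v y) ∧ not (x == u) ∧ not (y == v)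

  record Valid (G : Adj n) (x y : Fin n) : Set where
    field
      xy∈G : G x y ≡ true
      x∉Z  : Z x ≡ false
      xy∉F : F x y ≡ false
      ux∉G : G u x ≡ false
      vy∉G : G v y ≡ false
      x≢u  : ¬ x ≡ u
      y≢v  : ¬ y ≡ v

  valid-sound : ∀ {G x y} → validᵇ G x y ≡ true → Valid G x y
  valid-sound {G} {x} {y} h
    with G x y in a | Z x in b | F x y in c | G u x in e | G v y in f | x == u in g | y == v in k
  ... | true | false | false | false | false | false | false =
    record { xy∈G = a ; x∉Z = b ; xy∉F = c ; ux∉G = e ; vy∉G = f ; x≢u = ==-false g ; y≢v = ==-false k }
  ... | false | _ | _ | _ | _ | _ | _ = false≢true h
  ... | true | true | _ | _ | _ | _ | _ = false≢true h
  ... | true | false | true | _ | _ | _ | _ = false≢true h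
  ... | true | false | false | true | _ | _ | _ = false≢true h
  ... | true | false | false | false | true | _ | _ = false≢true h
  ... | true | false | false | false | false | true | _ = false≢true h
  ... | true | false | false | false | false | false | true = false≢true h

  #valid : Adj n → ℕ
  #valid G = ∑² (λ x y → 𝟙 (validᵇ G x y))

  K≤K² : K ≤ K * K
  K≤K² with K
  ... | zero = z≤n
  ... | suc k = m≤m*n (suc k) (suc k)

  module _ {G : Adj n} (adm : Admissible G) where
    open Admissible adm

    row-sum : ∀ x → ∑ (λ y → 𝟙 (G x y)) ≡ d x
    row-sum x = trans (sym (deg-as-∑ G x)) (degrees x)

    -- By (E2) a vertex y of large degree has d(y) = d_H(y); since H's row of y
    -- is contained in G's, the two rows coincide and all neighbours lie in Z.
    large⇒neighbours-in-Z : ∀ y → n < d y ^ 4 → ∀ x → G y x ≡ true → Z x ≡ true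
    large⇒neighbours-in-Z y large x yx∈G = proj₂ (H-on-Z y x (trans (sym rows-agree) yx∈G))
      where
      y∈Z : Z y ≡ true
      y∈Z = proj₁ (E2 y large)
      H⊆G : ∀ x → 𝟙 (H y x) ≤ 𝟙 (G y x)
      H⊆G x with H y x in yx∈H
      ... | false = z≤n
      ... | true = ≤-reflexive (cong 𝟙 (sym (trans (induces y x y∈Z (proj₂ (H-on-Z y x yx∈H))) yx∈H)))
      same-size : ∑ (λ x → 𝟙 (H y x)) ≡ ∑ (λ x → 𝟙 (G y x))
      same-size = trans (sym (deg-as-∑ H y)) (trans (sym (proj₂ (E2 y large))) (sym (row-sum y)))
      rows-agree : G y x ≡ H y x
      rows-agree = sym (𝟙-injective (∑-tight H⊆G same-size x))


    -- Since F ⊆ G, the edges xy ∈ G ∖ F with x ∉ Z number exactly slack d Z F.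
    slack-as-∑² : ∑² (λ x y → 𝟙 (not (Z x)) * 𝟙 (G x y ∧ not (F x y))) ≡ slack d Z F
    slack-as-∑² = trans (sum-cong-≗ per-row) (sym (sum-allFin (λ w → if Z w then 0 else (d w ∸ deg F w))))
      where
      G∖F-row : ∀ x → ∑ (λ y → 𝟙 (G x y ∧ not (F x y))) ≡ d x ∸ deg F x
      G∖F-row x = trans (sym (m+n∸n≡m _ (deg F x))) (cong (_∸ deg F x) (begin
        ∑ (λ y → 𝟙 (G x y ∧ not (F x y))) + deg F x
          ≡⟨ cong (∑ (λ y → 𝟙 (G x y ∧ not (F x y))) +_) (deg-as-∑ F x) ⟩
        ∑ (λ y → 𝟙 (G x y ∧ not (F x y))) + ∑ (λ y → 𝟙 (F x y))
          ≡⟨ ∑-distrib-+ (λ y → 𝟙 (G x y ∧ not (F x y))) (λ y → 𝟙 (F x y)) ⟨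
        ∑ (λ y → 𝟙 (G x y ∧ not (F x y)) + 𝟙 (F x y))
          ≡⟨ sum-cong-≗ F-split ⟩
        ∑ (λ y → 𝟙 (G x y))
          ≡⟨ row-sum x ⟩
        d x ∎))
        where
        open ≡-Reasoning
        F-split : ∀ y → 𝟙 (G x y ∧ not (F x y)) + 𝟙 (F x y) ≡ 𝟙 (G x y)
        F-split y with F x y in xy∈F | G x y in xy∈G
        ... | true | true = refl
        ... | true | false = false≢true (trans (sym xy∈G) (contains x y xy∈F))
        ... | false | g = trans (+-identityʳ (𝟙 (g ∧ true))) (cong 𝟙 (∧-identityʳ g))
      per-row : ∀ x → ∑ (λ y → 𝟙 (not (Z x)) * 𝟙 (G x y ∧ not (F x y))) ≡ (if Z x then 0 else (d x ∸ deg F x))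
      per-row x with Z x
      ... | true = ∑-zero (λ y → 0 * 𝟙 (G x y ∧ not (F x y))) (λ _ → refl)
      ... | false = trans (sum-cong-≗ {n} (λ y → +-identityʳ (𝟙 (G x y ∧ not (F x y))))) (G∖F-row x)

    through-ux : ∑² (λ x y → 𝟙 (G u x) * (𝟙 (not (Z x)) * 𝟙 (G x y))) ≤ K * K
    through-ux = begin
      ∑² (λ x y → 𝟙 (G u x) * (𝟙 (not (Z x)) * 𝟙 (G x y)))
        ≡⟨ sum-cong-≗ factor ⟩
      ∑ (λ x → 𝟙 (G u x) * (𝟙 (not (Z x)) * d x))
        ≤⟨ ∑-mono (λ x → *-monoʳ-≤ (𝟙 (G u x)) (outside-row x)) ⟩
      ∑ (λ x → 𝟙 (G u x) * K)
        ≡⟨ *-distribʳ-sum K (λ x → 𝟙 (G u x)) ⟨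
      ∑ (λ x → 𝟙 (G u x)) * K
        ≡⟨ cong (_* K) (row-sum u) ⟩
      d u * K
        ≤⟨ *-monoˡ-≤ K du≤K ⟩
      K * K ∎
      where
      open ≤-Reasoning
      factor : ∀ x → ∑ (λ y → 𝟙 (G u x) * (𝟙 (not (Z x)) * 𝟙 (G x y))) ≡ 𝟙 (G u x) * (𝟙 (not (Z x)) * d x)
      factor x = trans (sym (*-distribˡ-sum (𝟙 (G u x)) (λ y → 𝟙 (not (Z x)) * 𝟙 (G x y))))
        (cong (𝟙 (G u x) *_) (trans (sym (*-distribˡ-sum (𝟙 (not (Z x))) (λ y → 𝟙 (G x y))))
          (cong (𝟙 (not (Z x)) *_) (row-sum x))))
      outside-row : ∀ x → 𝟙 (not (Z x)) * d x ≤ K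
      outside-row x with Z x in x∈Z
      ... | true = z≤n
      ... | false = ≤-trans (≤-reflexive (+-identityʳ (d x))) (outside⇒≤K x x∈Z)

    -- Every vertex y has at most K neighbours outside Z: if d(y) is large,
    -- it has none.
    outside-column : ∀ y → ∑ (λ x → 𝟙 (not (Z x)) * 𝟙 (G x y)) ≤ K
    outside-column y with d y ^ 4 ≤? n
    ... | yes small = begin
      ∑ (λ x → 𝟙 (not (Z x)) * 𝟙 (G x y)) ≤⟨ ∑-mono (λ x → 𝟙*≤ (not (Z x)) (𝟙 (G x y))) ⟩
      ∑ (λ x → 𝟙 (G x y))                  ≡⟨ sum-cong-≗ (λ x → cong 𝟙 (symmetric x y)) ⟩
      ∑ (λ x → 𝟙 (G y x))                  ≡⟨ row-sum y ⟩
      d y                                  ≤⟨ small⇒≤K y small ⟩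
      K                                    ∎
      where open ≤-Reasoning
    ... | no large = ≤-trans (≤-reflexive (∑-zero (λ x → 𝟙 (not (Z x)) * 𝟙 (G x y)) none)) z≤n
      where
      none : ∀ x → 𝟙 (not (Z x)) * 𝟙 (G x y) ≡ 0
      none x with G x y in xy∈G
      ... | false = *-zeroʳ (𝟙 (not (Z x)))
      ... | true rewrite large⇒neighbours-in-Z y (≰⇒> large) x (trans (symmetric y x) xy∈G) = refl

    through-vy : ∑² (λ x y → 𝟙 (G v y) * (𝟙 (not (Z x)) * 𝟙 (G x y))) ≤ K * K
    through-vy = begin
      ∑² (λ x y → 𝟙 (G v y) * (𝟙 (not (Z x)) * 𝟙 (G x y)))
        ≡⟨ ∑-comm (λ x y → 𝟙 (G v y) * (𝟙 (not (Z x)) * 𝟙 (G x y))) ⟩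
      ∑ (λ y → ∑ (λ x → 𝟙 (G v y) * (𝟙 (not (Z x)) * 𝟙 (G x y))))
        ≡⟨ sum-cong-≗ (λ y → *-distribˡ-sum (𝟙 (G v y)) (λ x → 𝟙 (not (Z x)) * 𝟙 (G x y))) ⟨
      ∑ (λ y → 𝟙 (G v y) * ∑ (λ x → 𝟙 (not (Z x)) * 𝟙 (G x y)))
        ≤⟨ ∑-mono (λ y → *-monoʳ-≤ (𝟙 (G v y)) (outside-column y)) ⟩
      ∑ (λ y → 𝟙 (G v y) * K)
        ≡⟨ *-distribʳ-sum K (λ y → 𝟙 (G v y)) ⟨
      ∑ (λ y → 𝟙 (G v y)) * K
        ≡⟨ cong (_* K) (row-sum v) ⟩
      d v * K
        ≤⟨ *-monoˡ-≤ K dv≤K ⟩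
      K * K ∎
      where open ≤-Reasoning

    at-u : ∑² (λ x y → 𝟙 (x == u) * 𝟙 (G x y)) ≤ K * K
    at-u = begin
      ∑² (λ x y → 𝟙 (x == u) * 𝟙 (G x y))
        ≡⟨ sum-cong-≗ (λ x → *-distribˡ-sum (𝟙 (x == u)) (λ y → 𝟙 (G x y))) ⟨
      ∑ (λ x → 𝟙 (x == u) * ∑ (λ y → 𝟙 (G x y)))
        ≡⟨ ∑-δ u (λ x → ∑ (λ y → 𝟙 (G x y))) ⟩
      ∑ (λ y → 𝟙 (G u y))
        ≡⟨ row-sum u ⟩
      d u
        ≤⟨ ≤-trans du≤K K≤K² ⟩
      K * K ∎
      where open ≤-Reasoning

    at-v : ∑² (λ x y → 𝟙 (y == v) * 𝟙 (G x y)) ≤ K * K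
    at-v = begin
      ∑² (λ x y → 𝟙 (y == v) * 𝟙 (G x y))
        ≡⟨ sum-cong-≗ (λ x → trans (∑-δ v (λ y → 𝟙 (G x y))) (cong 𝟙 (symmetric x v))) ⟩
      ∑ (λ x → 𝟙 (G v x))
        ≡⟨ row-sum v ⟩
      d v
        ≤⟨ ≤-trans dv≤K K≤K² ⟩
      K * K ∎
      where open ≤-Reasoning

    valid-lower-bound : slack d Z F ∸ 4 * (K * K) ≤ #valid G
    valid-lower-bound = m≤n+o⇒m∸n≤o (slack d Z F) (4 * (K * K)) (begin
      slack d Z F
        ≡⟨ slack-as-∑² ⟨
      ∑² (λ x y → 𝟙 (not (Z x)) * 𝟙 (G x y ∧ not (F x y)))
        ≤⟨ ∑²-mono (λ x y → valid-or-invalid (G x y) (Z x) (F x y) (G u x) (G v y) (x == u) (y == v)) ⟩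
      ∑² (λ x y → 𝟙 (validᵇ G x y) + invalid x y)
        ≡⟨ ∑²-+ (λ x y → 𝟙 (validᵇ G x y)) invalid ⟩
      #valid G + ∑² invalid
        ≡⟨ cong (#valid G +_) (split-invalid) ⟩
      #valid G + (∑² ux + ∑² vy + ∑² xu + ∑² yv)
        ≤⟨ +-monoʳ-≤ (#valid G) (+-mono-≤ (+-mono-≤ (+-mono-≤ through-ux through-vy) at-u) at-v) ⟩
      #valid G + (K * K + K * K + K * K + K * K)
        ≡⟨ +-comm (#valid G) _ ⟩
      K * K + K * K + K * K + K * K + #valid G
        ≡⟨ cong (_+ #valid G) (four-copies (K * K)) ⟩
      4 * (K * K) + #valid G ∎)
      where
      open ≤-Reasoning
      ux vy xu yv invalid : Fin n → Fin n → ℕ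
      ux x y = 𝟙 (G u x) * (𝟙 (not (Z x)) * 𝟙 (G x y))
      vy x y = 𝟙 (G v y) * (𝟙 (not (Z x)) * 𝟙 (G x y))
      xu x y = 𝟙 (x == u) * 𝟙 (G x y)
      yv x y = 𝟙 (y == v) * 𝟙 (G x y)
      invalid x y = ux x y + vy x y + xu x y + yv x y
      split-invalid : ∑² invalid ≡ ∑² ux + ∑² vy + ∑² xu + ∑² yv
      split-invalid = trans (∑²-+ (λ x y → ux x y + vy x y + xu x y) yv)
        (cong (_+ ∑² yv) (trans (∑²-+ (λ x y → ux x y + vy x y) xu) (cong (_+ ∑² xu) (∑²-+ ux vy))))
      four-copies : ∀ k → k + k + k + k ≡ 4 * k
      four-copies = solve-∀

  switch : Fin n → Fin n → Adj n → Adj n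
  switch x y = replace (edge u v) (edge x y) (edge u x) (edge v y)

  unswitch : Fin n → Fin n → Adj n → Adj n
  unswitch x y = replace (edge u x) (edge v y) (edge u v) (edge x y)

  module Switch {G : Adj n} (adm : Admissible G) (uv∈G : G u v ≡ true) {x y : Fin n} (valid : Valid G x y) where
    open Admissible adm
    open Valid valid

    u≢v : ¬ u ≡ v
    u≢v u≡v = false≢true (trans (sym (loopless u)) (subst (λ w → G u w ≡ true) (sym u≡v) uv∈G))

    u≢x : ¬ u ≡ x
    u≢x u≡x = x≢u (sym u≡x)

    u≢y : ¬ u ≡ y
    u≢y u≡y = false≢true (trans (sym vy∉G) (subst (λ w → G v w ≡ true) u≡y (trans (symmetric v u) uv∈G)))

    x≢y : ¬ x ≡ y
    x≢y x≡y = false≢true (trans (sym (loopless x)) (subst (λ w → G x w ≡ true) (sym x≡y) xy∈G))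

    v≢y : ¬ v ≡ y
    v≢y v≡y = y≢v (sym v≡y)

    in-G : ∀ {a c} → G a c ≡ true → ∀ i j → edge a c i j ≡ true → G i j ≡ true
    in-G {a} {c} ac∈G i j = edge-elim (λ i j → G i j ≡ true) ac∈G (trans (symmetric c a) ac∈G)

    not-in-G : ∀ {a c} → G a c ≡ false → ∀ i j → edge a c i j ≡ true → G i j ≡ false
    not-in-G {a} {c} ac∉G i j = edge-elim (λ i j → G i j ≡ false) ac∉G (trans (symmetric c a) ac∉G)

    is-switching : Switching G (edge u v) (edge x y) (edge u x) (edge v y)
    is-switching = record
      { e₁∈G = in-G uv∈G
      ; e₂∈G = in-G xy∈G
      ; f₁∉G = not-in-G ux∉G
      ; f₂∉G = not-in-G vy∉G
      ; e-distinct = λ i j → edge-distinct {a = u} {v} {x} {y} {i} {j} u≢x u≢y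
      ; f-distinct = λ i j → edge-distinct {a = u} {x} {v} {y} {i} {j} u≢v u≢y
      }

    S : Adj n
    S = switch x y G

    degree-balance : ∀ w → ∑ (λ j → 𝟙 (edge u v w j)) + ∑ (λ j → 𝟙 (edge x y w j))
                         ≡ ∑ (λ j → 𝟙 (edge u x w j)) + ∑ (λ j → 𝟙 (edge v y w j))
    degree-balance w = begin
      ∑ (λ j → 𝟙 (edge u v w j)) + ∑ (λ j → 𝟙 (edge x y w j))
        ≡⟨ cong₂ _+_ (edge-degree u≢v w) (edge-degree x≢y w) ⟩
      𝟙 (w == u) + 𝟙 (w == v) + (𝟙 (w == x) + 𝟙 (w == y))
        ≡⟨ interchange (𝟙 (w == u)) (𝟙 (w == v)) (𝟙 (w == x)) (𝟙 (w == y)) ⟩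
      𝟙 (w == u) + 𝟙 (w == x) + (𝟙 (w == v) + 𝟙 (w == y))
        ≡⟨ cong₂ _+_ (edge-degree u≢x w) (edge-degree v≢y w) ⟨
      ∑ (λ j → 𝟙 (edge u x w j)) + ∑ (λ j → 𝟙 (edge v y w j)) ∎
      where
      open ≡-Reasoning
      interchange : ∀ a b c e → a + b + (c + e) ≡ a + c + (b + e)
      interchange = solve-∀

    off-Z : ∀ {a c} → Z a ≡ false ⊎ Z c ≡ false → ∀ {i j} → Z i ≡ true → Z j ≡ true → edge a c i j ≡ false
    off-Z {a} {c} (inj₁ a∉Z) zi zj = edge-outside Z {a} {c} a∉Z zi zj
    off-Z {a} {c} (inj₂ c∉Z) {i} {j} zi zj = trans (edge-swap a c i j) (edge-outside Z {c} {a} c∉Z zi zj)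

    off-F : ∀ {a c} → F a c ≡ false → ∀ {i j} → F i j ≡ true → edge a c i j ≡ false
    off-F {a} {c} ac∉F {i} {j} ij∈F = edge-absent {a = a} {c} {i} {j} λ h →
      false≢true (trans (sym (edge-elim (λ i j → F i j ≡ false) ac∉F (trans (proj₂ F-simple c a) ac∉F) h)) ij∈F)

    switch-admissible : Admissible S
    switch-admissible = record
      { loopless  = λ i → S-loopless i
      ; symmetric = S-symmetric
      ; degrees   = λ w → trans (switching-degree is-switching w (degree-balance w)) (degrees w)
      ; induces   = S-induces
      ; contains  = S-contains
      }
      where
      S-loopless : ∀ i → S i i ≡ false
      S-loopless i rewrite loopless i | edge-loop u≢x i | edge-loop v≢y i = refl
      S-symmetric : ∀ i j → S i j ≡ S j i
      S-symmetric i j rewrite symmetric i j | edge-flip u v i j | edge-flip x y i j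
                            | edge-flip u x i j | edge-flip v y i j = refl
      S-induces : ∀ i j → Z i ≡ true → Z j ≡ true → S i j ≡ H i j
      S-induces i j zi zj
        rewrite off-Z {u} {v} (inj₂ v∉Z) zi zj | off-Z {x} {y} (inj₁ x∉Z) zi zj
              | off-Z {u} {x} (inj₂ x∉Z) zi zj | off-Z {v} {y} (inj₁ v∉Z) zi zj
        = trans (∨-identityʳ _) (trans (∧-identityʳ _) (induces i j zi zj))
      S-contains : ∀ i j → F i j ≡ true → S i j ≡ true
      S-contains i j ij∈F
        rewrite contains i j ij∈F | off-F uv∉F ij∈F | off-F xy∉F ij∈F = refl

    switch-ux : S u x ≡ true
    switch-ux rewrite edge-present u x = ∨-zeroʳ _

    switch-vy : S v y ≡ true
    switch-vy rewrite edge-present v y | ∨-zeroʳ (edge u x v y) = ∨-zeroʳ _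

    switch-undo : ∀ i j → unswitch x y S i j ≡ G i j
    switch-undo = switching-undo is-switching

  switchesᵇ : Adj n → Fin n → Fin n → Adj n → Bool
  switchesᵇ G x y G' = (admissibleᵇ G ∧ G u v) ∧ validᵇ G x y ∧ admissibleᵇ G' ∧ sameAdj G' (switch x y G)

  #switches : Adj n → Adj n → ℕ
  #switches G G' = ∑² (λ x y → 𝟙 (switchesᵇ G x y G'))

  -- Each valid position of G yields exactly one switched graph, so an
  -- admissible G ∋ uv has at least slack ∸ 4K² switchings.
  outgoing : ∀ G → admissibleᵇ G ∧ G u v ≡ true → slack d Z F ∸ 4 * (K * K) ≤ ∑ₗ (allAdj n) (#switches G)
  outgoing G h = begin
    slack d Z F ∸ 4 * (K * K)
      ≤⟨ valid-lower-bound adm ⟩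
    #valid G
      ≡⟨ sum-cong-≗ (λ x → sum-cong-≗ (λ y → one-target x y)) ⟨
    ∑² (λ x y → ∑ₗ (allAdj n) (λ G' → 𝟙 (switchesᵇ G x y G')))
      ≡⟨ ∑ₗ-∑² (allAdj n) (λ G' x y → 𝟙 (switchesᵇ G x y G')) ⟨
    ∑ₗ (allAdj n) (#switches G) ∎
    where
    open ≤-Reasoning
    adm : Admissible G
    adm = admissible-sound (proj₁ (∧-true h))
    one-target : ∀ x y → ∑ₗ (allAdj n) (λ G' → 𝟙 (switchesᵇ G x y G')) ≡ 𝟙 (validᵇ G x y)
    one-target x y rewrite h with validᵇ G x y in valid
    ... | false = ∑ₗ-zero (allAdj n)
    ... | true = trans (∑ₗ-cong (allAdj n) admissible-for-free) (allAdj-unique n S)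
      where
      open Switch adm (proj₂ (∧-true {admissibleᵇ G} h)) (valid-sound valid)
      admissible-for-free : ∀ G' → 𝟙 (admissibleᵇ G' ∧ sameAdj G' S) ≡ 𝟙 (sameAdj G' S)
      admissible-for-free G' with sameAdj G' S in same
      ... | false = cong 𝟙 (∧-zeroʳ (admissibleᵇ G'))
      ... | true = cong 𝟙 (trans (∧-identityʳ (admissibleᵇ G'))
        (admissible-complete (admissible-transfer (λ i j → sym (sameAdj-sound same i j)) switch-admissible)))

  -- Conversely G' arises from at most one G for each position (x, y), and
  -- only for x ∈ N_G'(u), y ∈ N_G'(v): at most d(u) d(v) ≤ K² switchings.
  incoming : ∀ G' → ∑ₗ (allAdj n) (λ G → #switches G G') ≤ K * K * 𝟙 (admissibleᵇ G')
  incoming G' = begin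
    ∑ₗ (allAdj n) (λ G → #switches G G')
      ≡⟨ ∑ₗ-∑² (allAdj n) (λ G x y → 𝟙 (switchesᵇ G x y G')) ⟩
    ∑² (λ x y → ∑ₗ (allAdj n) (λ G → 𝟙 (switchesᵇ G x y G')))
      ≤⟨ ∑²-mono one-source ⟩
    ∑² (λ x y → a * (𝟙 (G' u x) * 𝟙 (G' v y)))
      ≡⟨ ∑²-*ˡ a (λ x → 𝟙 (G' u x)) (λ y → 𝟙 (G' v y)) ⟩
    a * (∑ (λ x → 𝟙 (G' u x)) * ∑ (λ y → 𝟙 (G' v y)))
      ≡⟨ cong (a *_) (cong₂ _*_ (deg-as-∑ G' u) (deg-as-∑ G' v)) ⟨
    a * (deg G' u * deg G' v)
      ≤⟨ degree-cap ⟩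
    K * K * a ∎
    where
    open ≤-Reasoning
    a : ℕ
    a = 𝟙 (admissibleᵇ G')
    degree-cap : a * (deg G' u * deg G' v) ≤ K * K * a
    degree-cap with admissibleᵇ G' in adm′
    ... | false = z≤n
    ... | true rewrite Admissible.degrees (admissible-sound adm′) u | Admissible.degrees (admissible-sound adm′) v
      = ≤-trans (≤-reflexive (+-identityʳ _)) (≤-trans (*-mono-≤ du≤K dv≤K) (≤-reflexive (sym (*-identityʳ (K * K)))))
    one-source : ∀ x y → ∑ₗ (allAdj n) (λ G → 𝟙 (switchesᵇ G x y G')) ≤ a * (𝟙 (G' u x) * 𝟙 (G' v y))
    one-source x y = begin
      ∑ₗ (allAdj n) (λ G → 𝟙 (switchesᵇ G x y G'))
        ≤⟨ ∑ₗ-mono (allAdj n) source ⟩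
      ∑ₗ (allAdj n) (λ G → c * 𝟙 (sameAdj G (unswitch x y G')))
        ≡⟨ ∑ₗ-*ˡ (allAdj n) c (λ G → 𝟙 (sameAdj G (unswitch x y G'))) ⟩
      c * ∑ₗ (allAdj n) (λ G → 𝟙 (sameAdj G (unswitch x y G')))
        ≡⟨ cong (c *_) (allAdj-unique n (unswitch x y G')) ⟩
      c * 1
        ≡⟨ *-identityʳ c ⟩
      c ∎
      where
      c : ℕ
      c = a * (𝟙 (G' u x) * 𝟙 (G' v y))
      source : ∀ G → 𝟙 (switchesᵇ G x y G') ≤ c * 𝟙 (sameAdj G (unswitch x y G'))
      source G with switchesᵇ G x y G' in sw
      ... | false = z≤n
      ... | true = 𝟙-all (admissibleᵇ G') (G' u x) (G' v y) (sameAdj G (unswitch x y G'))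
                     adm′ G'ux G'vy (sameAdj-complete G≗unswitch)
        where
        G∋uv : admissibleᵇ G ∧ G u v ≡ true
        G∋uv = proj₁ (∧-true sw)
        rest : validᵇ G x y ∧ admissibleᵇ G' ∧ sameAdj G' (switch x y G) ≡ true
        rest = proj₂ (∧-true {admissibleᵇ G ∧ G u v} sw)
        adm′ : admissibleᵇ G' ≡ true
        adm′ = proj₁ (∧-true (proj₂ (∧-true {validᵇ G x y} rest)))
        G'≗S : ∀ i j → G' i j ≡ switch x y G i j
        G'≗S = sameAdj-sound (proj₂ (∧-true {admissibleᵇ G'} (proj₂ (∧-true {validᵇ G x y} rest))))
        open Switch (admissible-sound (proj₁ (∧-true G∋uv))) (proj₂ (∧-true {admissibleᵇ G} G∋uv))
                    (valid-sound (proj₁ (∧-true rest)))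
        G'ux : G' u x ≡ true
        G'ux = trans (G'≗S u x) switch-ux
        G'vy : G' v y ≡ true
        G'vy = trans (G'≗S v y) switch-vy
        G≗unswitch : ∀ i j → G i j ≡ unswitch x y G' i j
        G≗unswitch i j = trans (sym (switch-undo i j))
          (cong (λ g → replaceᵇ g (edge u x i j) (edge v y i j) (edge u v i j) (edge x y i j)) (sym (G'≗S i j)))

  switching-bound : (slack d Z F ∸ 4 * (K * K)) * edgeCondCount d Z H F u v ≤ K * K * condCount d Z H F
  switching-bound = subst₂ (λ A B → (slack d Z F ∸ 4 * (K * K)) * A ≤ K * K * B)
    (sym (trans (length-filter _ (allAdj n)) (∑ₗ-cong (allAdj n) (λ G → cong 𝟙 (edge-condition G)))))
    (sym (length-filter admissibleᵇ (allAdj n)))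
    (switching-inequality (allAdj n) (allAdj n) #switches (λ G → admissibleᵇ G ∧ G u v) admissibleᵇ
      (slack d Z F ∸ 4 * (K * K)) (K * K) outgoing incoming)
    where
    edge-condition : ∀ G → isSimpleᵇ G ∧ hasDegreesᵇ G d ∧ inducedEqᵇ G Z H ∧ subgraphᵇ F G ∧ G u v
                  ≡ admissibleᵇ G ∧ G u v
    edge-condition G = sym (trans (∧-assoc (isSimpleᵇ G) _ (G u v)) (cong (isSimpleᵇ G ∧_)
      (trans (∧-assoc (hasDegreesᵇ G d) _ (G u v)) (cong (hasDegreesᵇ G d ∧_) (∧-assoc (inducedEqᵇ G Z H) _ (G u v))))))

lemma8p1 : Σ ℕ (λ n₀ → ∀ (n : ℕ) → n₀ ≤ n →
    (Z : Subset n) (H F : Adj n) (u v : Fin n) (d : Fin n → ℕ) →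
    IsSimple H → OnVertexSet H Z →
    IsSimple F → BipartiteAcross F Z →
    Z v ≡ false → F u v ≡ false →
    (∀ w → 1 ≤ d w) → Realisable d →
    d u ^ 4 ≤ n →
    (∀ w → n < d w ^ 4 → Z w ≡ true × d w ≡ deg H w) →
    n ≤ 20 * slack d Z F →
    0 < condCount d Z H F →
    edgeCondCount d Z H F u v ^ 2 * n ≤ 1600 * condCount d Z H F ^ 2)
lemma8p1 = 25600 , λ n n-large Z H F u v d _ H-on-Z F-simple _ v∉Z uv∉F _ _ E1 E2 E3 _ →
  let open Setting Z H F u v d H-on-Z F-simple v∉Z uv∉F E1 E2 in
  ratio-bound n (slack d Z F) K (edgeCondCount d Z H F u v) (condCount d Z H F)
    n-large K⁴≤n E3 switching-bound
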